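{- Let $r\geq 2$ and let $H$ and $G$ be $r$-graphs. The constrained Ramsey number $f(H,G)$ exists if and only if there is a positive integer $t$ such that for all subsets $J\subseteq[r]$, either $H$ is isomorphic to a monochromatic subgraph in a $J$-Canonical edge-coloring of $K^{(r)}_t$, or $G$ is isomorphic to a rainbow subgraph in a $J$-Canonical edge-coloring of $K^{(r)}_t$.
   Context: $K^{(r)}_t$ is the complete $r$-uniform hypergraph on $t$ vertices. For an $r$-graph with a linearly ordered vertex set $v_1<\cdots<v_t$, $J\subseteq[r]$, and an edge $e=\{v_{i_1},\ldots,v_{i_r}\}$ with $i_1<\cdots<i_r$, write $e:J=\{v_{i_j}:j\in J\}$; an edge-coloring is $J$-Canonical (with respect to some ordering of the vertices) if for all edges $e,e'$, $c(e)=c(e')$ iff $e:J=e':J$. A subgraph is monochromatic if all its edges have one color, rainbow if its edges have pairwise distinct colors. $f(H,G)$ is the minimum $n$ such that every edge-coloring of $K^{(r)}_n$ with any number of colors contains a monochromatic copy of $H$ or a rainbow copy of $G$. -}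

module Defs where

open import Data.Nat using (ℕ; zero; suc)
open import Data.Bool using (Bool; true; false; _∧_)
open import Data.Fin using (Fin; toℕ)
open import Data.Fin.Properties using (_≟_; _<?_; any?)
open import Data.Fin.Subset using (Subset; ∣_∣; _∩_)
open import Data.Vec using (Vec; []; _∷_; lookup; tabulate)
open import Data.Product using (Σ; ∃; _×_; _,_)
open import Data.Product.Properties using ()
open import Relation.Nullary using (does)
open import Relation.Nullary.Decidable using (_×-dec_)
open import Relation.Binary.PropositionalEquality using (_≡_)
open import Data.Bool.Properties using () renaming (_≟_ to _≟ᵇ_)
open import Function.Definitions using (Injective)

record RGraph (r : ℕ) : Set₁ where
  field
    m       : ℕ
    E       : Subset m → Set
    uniform : ∀ e → E e → ∣ e ∣ ≡ r
open RGraph public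

-- Edge-colourings of K^{(r)}_n (vertex set Fin n, natural order) with
-- colours in ℕ.  A colouring is a function on subsets; only its values
-- on r-subsets (the edges of K^{(r)}_n) are ever used.
Coloring : ℕ → Set
Coloring n = Subset n → ℕ

image : ∀ {m n} → (Fin m → Fin n) → Subset m → Subset n
image {m} φ e = tabulate λ y → does (any? λ x → (lookup e x ≟ᵇ true) ×-dec (φ x ≟ y))

-- (ℕ-indexed) lookup in a subset of Fin r, false when out of range
lookupℕ : ∀ {r} → Subset r → ℕ → Bool
lookupℕ []       _       = false
lookupℕ (b ∷ bs) zero    = b
lookupℕ (b ∷ bs) (suc k) = lookupℕ bs k

rank : ∀ {n} → Subset n → Fin n → ℕ
rank e x = ∣ e ∩ tabulate (λ y → does (y <? x)) ∣

-- e : J  =  { v_{i_j} : j ∈ J } where v_{i_1} < ... < v_{i_r} are the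
-- elements of e; the element of rank k (0-based) is v_{i_{k+1}}, and
-- J ⊆ [r] is represented as a subset of Fin r (index k ↔ k+1).
_∶_ : ∀ {n r} → Subset n → Subset r → Subset n
e ∶ J = tabulate λ x → lookup e x ∧ lookupℕ J (rank e x)

JCanonical : ∀ {r n} → Subset r → Coloring n → Set
JCanonical {r} J c = ∀ e e' → ∣ e ∣ ≡ r → ∣ e' ∣ ≡ r →
  (c e ≡ c e' → (e ∶ J) ≡ (e' ∶ J)) × ((e ∶ J) ≡ (e' ∶ J) → c e ≡ c e')

MonoCopy : ∀ {r n} → RGraph r → Coloring n → Set
MonoCopy {n = n} H c =
  Σ (Fin (m H) → Fin n) λ φ → Injective _≡_ _≡_ φ ×
    ∃ λ col → ∀ e → E H e → c (image φ e) ≡ col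

RainbowCopy : ∀ {r n} → RGraph r → Coloring n → Set
RainbowCopy {n = n} G c =
  Σ (Fin (m G) → Fin n) λ φ → Injective _≡_ _≡_ φ ×
    (∀ e e' → E G e → E G e' → c (image φ e) ≡ c (image φ e') → e ≡ e')

open import Data.Sum using (_⊎_)

Arrows : ∀ {r} → ℕ → RGraph r → RGraph r → Set
Arrows n H G = (c : Coloring n) → MonoCopy H c ⊎ RainbowCopy G c

-- f(H,G) exists: some n has the property (then a least one exists)
fExists : ∀ {r} → RGraph r → RGraph r → Set
fExists H G = ∃ λ n → Arrows n H G

-- (⇒) If every colouring of K_n^(r) has a monochromatic H or a rainbow G, so does every colouring
-- of K_(n+1)^(r). All J-canonical colourings induce the same partition of the r-sets, and whether a
-- copy is monochromatic or rainbow depends only on that partition, so the hypothesis applied to the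
-- colouring e ↦ e:J settles J for all J-canonical colourings at once.
-- (⇐) By the Erdős–Rado canonical Ramsey theorem every colouring of K_N^(r), N large, is
-- J-canonical on some t-set for some J, and the hypothesis for that J yields the copy. For the
-- canonical Ramsey theorem, iterated Ramsey gives a large set on which whether two r-sets have the
-- same colour depends only on their relative order type. Let J be the positions i at which moving
-- the i-th element one step changes the colour. Moving elements at positions outside J never does,
-- so e:J = e′:J forces equal colours. Conversely, inside a spread-out subset an element of e:J
-- missing from e′:J could be moved one step (together with its copy in e′, if it lies there at a
-- position outside J) without changing the order type relative to e′, so equal colours force
-- e:J ⊆ e′:J.
module Submission where

open import Data.Bool using (Bool; true; false; not; T; _∧_)
open import Data.Bool.Properties using () renaming (_≟_ to _≟ᵇ_)
open import Data.Empty using (⊥-elim)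
open import Data.Fin using (Fin; zero; suc)
import Data.Fin.Properties as Fin
open import Data.Fin.Properties using (any?) renaming (_≟_ to _≟ᶠ_)
open import Data.Fin.Subset using (Subset; _∈_; _∉_; _⊆_; ∣_∣; _∩_; _∪_; ⁅_⁆) renaming (⊥ to ∅)
open import Data.Fin.Subset.Properties
  using (anySubset?; drop-there; ⊆-antisym; _∈?_; x∈p∪q⁺; x∈p∪q⁻; x∈⁅x⁆; x∈⁅y⁆⇒x≡y; ∪-identityˡ;
         Empty-unique; ∣⊥∣≡0)
open import Data.Nat using (ℕ; zero; suc; _+_; _*_; _≤_; _<_; z≤n; s≤s; _≡ᵇ_)
open import Data.Nat.Properties
  using (_≟_; _≤?_; ≤-total; ≤-trans; m≤m+n; n≤1+n; m≤n⇒m≤1+n; m<1+n⇒m<n∨m≡n; +-suc;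
         +-monoˡ-≤; +-monoʳ-≤; +-cancelˡ-≤; suc-injective; *-cancelˡ-≡; even≢odd; ≡ᵇ⇒≡; ≡⇒≡ᵇ)
open import Data.Product using (Σ; ∃; ∃₂; ∃-syntax; _×_; _,_; proj₁; proj₂)
open import Data.Sum using (_⊎_; inj₁; inj₂; [_,_]′)
import Data.Sum as Sum
open import Data.Unit using (⊤; tt)
open import Data.Vec using ([]; _∷_; lookup; tabulate; here; there)
open import Data.Vec.Properties
  using (∷-injectiveˡ; ∷-injectiveʳ; lookup∘tabulate; tabulate∘lookup; tabulate-cong;
         []=⇒lookup; lookup⇒[]=)
open import Function using (_∘_; case_of_; _⇔_; mk⇔; Equivalence; Injective)
open import Relation.Nullary using (Dec; yes; no; does; contradiction)
open import Relation.Nullary.Decidable using (_×-dec_; dec-true)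
open import Relation.Binary.PropositionalEquality hiding (J)

open import Defs

private
  variable
    a b k l n r t N : ℕ

-- Thinnings

-- k ⊑ n is an order-preserving injection Fin k → Fin n, i.e. a k-subset of Fin n; the outermost
-- constructor decides about the least element of Fin n.
infix 4 _⊑_
data _⊑_ : ℕ → ℕ → Set where
  done : 0 ⊑ 0
  keep : k ⊑ n → suc k ⊑ suc n
  skip : k ⊑ n → k ⊑ suc n

⊑-refl : n ⊑ n
⊑-refl {zero}  = done
⊑-refl {suc n} = keep ⊑-refl

infixl 5 _⨾_
_⨾_ : a ⊑ b → b ⊑ n → a ⊑ n
s      ⨾ skip z = skip (s ⨾ z)
keep s ⨾ keep z = keep (s ⨾ z)
skip s ⨾ keep z = skip (s ⨾ z)
done   ⨾ done   = done

⨾-assoc : (s : a ⊑ b) (z : b ⊑ k) (y : k ⊑ n) → (s ⨾ z) ⨾ y ≡ s ⨾ (z ⨾ y)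
⨾-assoc s        z        (skip y) = cong skip (⨾-assoc s z y)
⨾-assoc s        (skip z) (keep y) = cong skip (⨾-assoc s z y)
⨾-assoc (keep s) (keep z) (keep y) = cong keep (⨾-assoc s z y)
⨾-assoc (skip s) (keep z) (keep y) = cong skip (⨾-assoc s z y)
⨾-assoc done     done     done     = refl

⨾-identityˡ : (s : k ⊑ n) → ⊑-refl ⨾ s ≡ s
⨾-identityˡ (skip s) = cong skip (⨾-identityˡ s)
⨾-identityˡ (keep s) = cong keep (⨾-identityˡ s)
⨾-identityˡ done     = refl

⨾-identityʳ : (s : k ⊑ n) → s ⨾ ⊑-refl ≡ s
⨾-identityʳ (skip s) = cong skip (⨾-identityʳ s)
⨾-identityʳ (keep s) = cong keep (⨾-identityʳ s)
⨾-identityʳ done     = refl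

0⊑ : 0 ⊑ n
0⊑ {zero}  = done
0⊑ {suc n} = skip 0⊑

0⊑-unique : (s : 0 ⊑ n) → s ≡ 0⊑
0⊑-unique done     = refl
0⊑-unique (skip s) = cong skip (0⊑-unique s)

≤⇒⊑ : k ≤ n → k ⊑ n
≤⇒⊑ {n = zero}  z≤n     = done
≤⇒⊑ {n = suc n} z≤n     = skip (≤⇒⊑ z≤n)
≤⇒⊑             (s≤s p) = keep (≤⇒⊑ p)

⊑⇒≤ : k ⊑ n → k ≤ n
⊑⇒≤ done     = z≤n
⊑⇒≤ (keep s) = s≤s (⊑⇒≤ s)
⊑⇒≤ (skip s) = m≤n⇒m≤1+n (⊑⇒≤ s)

infixl 6 _↾_
_↾_ : {A : Set} → (k ⊑ N → A) → t ⊑ N → k ⊑ t → A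
(χ ↾ z) s = χ (s ⨾ z)

↾-⨾ : {A : Set} (χ : k ⊑ N → A) (y : n ⊑ N) (z : t ⊑ n) (s : k ⊑ t) →
      (χ ↾ (z ⨾ y)) s ≡ (χ ↾ y ↾ z) s
↾-⨾ χ y z s = cong χ (sym (⨾-assoc s z y))

-- Ramsey's theorem

Constant : {A X : Set} → (X → A) → Set
Constant {A} f = ∃ λ (x : A) → ∀ s → f s ≡ x

Ramsey : ℕ → ℕ → Set
Ramsey k t = ∃[ N ] ∀ (χ : k ⊑ N → Bool) → ∃ λ (z : t ⊑ N) → Constant (χ ↾ z)

-- The colour of a (k+1)-set depends only on its least element.
EndHomogeneous : ∀ n → (suc k ⊑ n → Bool) → Set
EndHomogeneous zero    χ = ⊤
EndHomogeneous (suc n) χ = Constant (λ s → χ (keep s)) × EndHomogeneous n (λ s → χ (skip s))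

endHomogeneous-resp : (χ χ′ : suc k ⊑ n → Bool) → (∀ s → χ s ≡ χ′ s) →
                      EndHomogeneous n χ → EndHomogeneous n χ′
endHomogeneous-resp {n = zero}  χ χ′ eq tt = tt
endHomogeneous-resp {n = suc n} χ χ′ eq ((b , hb) , h) =
  (b , λ s → trans (sym (eq (keep s))) (hb s)) , endHomogeneous-resp _ _ (λ s → eq (skip s)) h

endHomogeneous-ramsey : (∀ t → Ramsey k t) → ∀ n →
  ∃[ N ] ∀ (χ : suc k ⊑ N → Bool) → ∃ λ (y : n ⊑ N) → EndHomogeneous n (χ ↾ y)
endHomogeneous-ramsey ramsey zero = 0 , λ χ → done , tt
endHomogeneous-ramsey ramsey (suc n) with endHomogeneous-ramsey ramsey n
... | N , endHom with ramsey N
... | M , mono = suc M , λ χ →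
  let z , b , hz = mono (λ s → χ (keep s))
      y , h = endHom (λ s → χ (skip (s ⨾ z)))
  in keep (y ⨾ z) ,
     (b , λ s → trans (cong (λ u → χ (keep u)) (sym (⨾-assoc s y z))) (hz (s ⨾ y))) ,
     endHomogeneous-resp _ _ (λ s → cong (λ u → χ (skip u)) (⨾-assoc s y z)) h

record Bisection (χ : suc k ⊑ n → Bool) : Set where
  field
    p q          : ℕ
    p+q≡n        : p + q ≡ n
    trues        : p ⊑ n
    falses       : q ⊑ n
    trues-true   : ∀ s → (χ ↾ trues) s ≡ true
    falses-false : ∀ s → (χ ↾ falses) s ≡ false

bisect : (χ : suc k ⊑ n → Bool) → EndHomogeneous n χ → Bisection χ
bisect {n = zero} χ tt = record
  { p = 0 ; q = 0 ; p+q≡n = refl ; trues = done ; falses = done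
  ; trues-true = λ () ; falses-false = λ () }
bisect {n = suc n} χ ((true , hb) , h) = record
  { p = suc p ; q = q ; p+q≡n = cong suc p+q≡n
  ; trues = keep trues ; falses = skip falses
  ; trues-true = λ { (keep s) → hb (s ⨾ trues) ; (skip s) → trues-true s }
  ; falses-false = falses-false }
  where open Bisection (bisect _ h)
bisect {n = suc n} χ ((false , hb) , h) = record
  { p = p ; q = suc q ; p+q≡n = trans (+-suc p q) (cong suc p+q≡n)
  ; trues = skip trues ; falses = keep falses
  ; trues-true = trues-true
  ; falses-false = λ { (keep s) → hb (s ⨾ falses) ; (skip s) → falses-false s } }
  where open Bisection (bisect _ h)

pigeonhole : ∀ {p q} → p + q ≡ t + t → t ≤ p ⊎ t ≤ q
pigeonhole {t} {p} {q} p+q≡t+t with ≤-total t p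
... | inj₁ t≤p = inj₁ t≤p
... | inj₂ p≤t = inj₂ (+-cancelˡ-≤ t t q (subst (_≤ t + q) p+q≡t+t (+-monoˡ-≤ q p≤t)))

monochromatic-⨾ : {A : Set} {x : A} (χ : k ⊑ N → A) (y : n ⊑ N) (z : t ⊑ n) →
                  (∀ s → (χ ↾ y ↾ z) s ≡ x) → ∀ s → (χ ↾ (z ⨾ y)) s ≡ x
monochromatic-⨾ χ y z h s = trans (↾-⨾ χ y z s) (h s)

monochromatic-shrink : {A : Set} {p : ℕ} (χ : k ⊑ N → A) (z : p ⊑ N) (x : A) →
                       (∀ s → (χ ↾ z) s ≡ x) → t ≤ p → ∃ λ (z : t ⊑ N) → Constant (χ ↾ z)
monochromatic-shrink χ z x hz t≤p =
  ≤⇒⊑ t≤p ⨾ z , x , monochromatic-⨾ χ z (≤⇒⊑ t≤p) (λ s → hz (s ⨾ ≤⇒⊑ t≤p))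

ramsey : ∀ k t → Ramsey k t
ramsey zero    t = t , λ χ → ⊑-refl , χ 0⊑ , λ s → cong χ (trans (⨾-identityʳ s) (0⊑-unique s))
ramsey (suc k) t with endHomogeneous-ramsey (ramsey k) (t + t)
... | N , endHom = N , λ χ →
  let y , h = endHom χ
      open Bisection (bisect (χ ↾ y) h)
  in [ monochromatic-shrink χ (trues ⨾ y) true (monochromatic-⨾ χ y trues trues-true)
     , monochromatic-shrink χ (falses ⨾ y) false (monochromatic-⨾ χ y falses falses-false)
     ]′ (pigeonhole p+q≡n)

-- Homogeneity with respect to order types

ColouringProperty : ℕ → Set₁
ColouringProperty r = ∀ {T} → (r ⊑ T → ℕ) → Set

-- Restrictions are only pointwise equal to c ↾ z (there is no function extensionality).
Hereditary : ColouringProperty r → Set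
Hereditary {r} P = ∀ {T T′} (c : r ⊑ T → ℕ) (c′ : r ⊑ T′ → ℕ) (z : T′ ⊑ T) →
                   (∀ e → c′ e ≡ (c ↾ z) e) → P c → P c′

Attainable : ColouringProperty r → Set
Attainable {r} P = ∀ t → ∃[ N ] ∀ (c : r ⊑ N → ℕ) → ∃ λ (z : t ⊑ N) → P (c ↾ z)

attainable-mono : {P Q : ColouringProperty r} →
                  (∀ {T} (c : r ⊑ T → ℕ) → P c → Q c) → Attainable P → Attainable Q
attainable-mono P⇒Q attain t =
  let N , f = attain t in N , λ c → let z , p = f c in z , P⇒Q (c ↾ z) p

attainable-× : {P Q : ColouringProperty r} → Hereditary P → Hereditary Q →
               Attainable P → Attainable Q → Attainable (λ c → P c × Q c)
attainable-× hereditaryP hereditaryQ attainP attainQ t =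
  let M , fQ = attainQ t
      N , fP = attainP M
  in N , λ c →
    let y , p = fP c
        z , q = fQ (c ↾ y)
    in z ⨾ y ,
       hereditaryP (c ↾ y) (c ↾ (z ⨾ y)) z (↾-⨾ c y z) p ,
       hereditaryQ (c ↾ y ↾ z) (c ↾ (z ⨾ y)) ⊑-refl
         (λ e → trans (↾-⨾ c y z e) (cong (c ↾ y ↾ z) (sym (⨾-identityʳ e)))) q

⋀ : (a ⊑ k → ColouringProperty r) → ColouringProperty r
⋀ P c = ∀ A → P A c

hereditary-⋀ : (P : a ⊑ k → ColouringProperty r) → (∀ A → Hereditary (P A)) → Hereditary (⋀ P)
hereditary-⋀ P hereditary c c′ z eq p A = hereditary A c c′ z eq (p A)

attainable-⋀ : (P : a ⊑ k → ColouringProperty r) → (∀ A → Hereditary (P A)) →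
               (∀ A → Attainable (P A)) → Attainable (⋀ P)
attainable-⋀ {zero}  {zero}  P hereditary attain =
  attainable-mono {P = P done} {Q = ⋀ P} (λ { c p done → p }) (attain done)
attainable-⋀ {zero}  {suc k} P hereditary attain =
  attainable-mono {P = ⋀ Pₛ} {Q = ⋀ P} (λ { c p (skip A) → p A })
    (attainable-⋀ Pₛ (λ A → hereditary (skip A)) (λ A → attain (skip A)))
  where
  Pₛ : zero ⊑ k → ColouringProperty _
  Pₛ A = P (skip A)
attainable-⋀ {suc a} {zero}  P hereditary attain t = t , λ c → ⊑-refl , λ ()
attainable-⋀ {suc a} {suc k} P hereditary attain =
  attainable-mono {P = λ c → ⋀ Pₖ c × ⋀ Pₛ c} {Q = ⋀ P}
    (λ { c (p , q) (keep A) → p A ; c (p , q) (skip A) → q A })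
    (attainable-× {P = ⋀ Pₖ} {Q = ⋀ Pₛ}
       (hereditary-⋀ Pₖ (λ A → hereditary (keep A)))
       (hereditary-⋀ Pₛ (λ A → hereditary (skip A)))
       (attainable-⋀ Pₖ (λ A → hereditary (keep A)) (λ A → attain (keep A)))
       (attainable-⋀ Pₛ (λ A → hereditary (skip A)) (λ A → attain (skip A))))
  where
  Pₖ : a ⊑ k → ColouringProperty _
  Pₖ A = P (keep A)
  Pₛ : suc a ⊑ k → ColouringProperty _
  Pₛ A = P (skip A)

Homogeneous : (A B : r ⊑ k) → ColouringProperty r
Homogeneous A B c = ∀ S S′ → c (A ⨾ S) ≡ c (B ⨾ S) → c (A ⨾ S′) ≡ c (B ⨾ S′)

homogeneous-hereditary : (A B : r ⊑ k) → Hereditary (Homogeneous A B)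
homogeneous-hereditary A B c c′ z c′≗c↾z hom S S′ eq =
  trans (pull A S′)
        (trans (hom (S ⨾ z) (S′ ⨾ z) (trans (sym (pull A S)) (trans eq (pull B S))))
               (sym (pull B S′)))
  where
  pull : ∀ X S → c′ (X ⨾ S) ≡ c (X ⨾ (S ⨾ z))
  pull X S = trans (c′≗c↾z (X ⨾ S)) (cong c (⨾-assoc X S z))

≡ᵇ-transfer : ∀ {x y x′ y′} → (x ≡ᵇ y) ≡ (x′ ≡ᵇ y′) → x ≡ y → x′ ≡ y′
≡ᵇ-transfer {x} {y} {x′} {y′} eq x≡y = ≡ᵇ⇒≡ x′ y′ (subst T eq (≡⇒≡ᵇ x y x≡y))

homogeneous-attainable : (A B : r ⊑ k) → Attainable (Homogeneous A B)
homogeneous-attainable {k = k} A B t =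
  let N , mono = ramsey k t in N , λ c →
  let z , b , hz = mono (λ S → c (A ⨾ S) ≡ᵇ c (B ⨾ S))
      agrees : ∀ S → ((c ↾ z) (A ⨾ S) ≡ᵇ (c ↾ z) (B ⨾ S)) ≡ b
      agrees S = trans (cong₂ (λ u v → c u ≡ᵇ c v) (⨾-assoc A S z) (⨾-assoc B S z)) (hz S)
  in z , λ S S′ → ≡ᵇ-transfer (trans (agrees S) (sym (agrees S′)))

HomogeneousAt : ∀ k → ColouringProperty r
HomogeneousAt {r} k = ⋀ λ (A : r ⊑ k) → ⋀ (Homogeneous A)

homogeneousAt-hereditary : ∀ k → Hereditary (HomogeneousAt {r} k)
homogeneousAt-hereditary k =
  hereditary-⋀ (λ A → ⋀ (Homogeneous A))
    (λ A → hereditary-⋀ (Homogeneous A) (homogeneous-hereditary A))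

homogeneousAt-attainable : ∀ k → Attainable (HomogeneousAt {r} k)
homogeneousAt-attainable k =
  attainable-⋀ (λ A → ⋀ (Homogeneous A))
    (λ A → hereditary-⋀ (Homogeneous A) (homogeneous-hereditary A))
    (λ A → attainable-⋀ (Homogeneous A) (homogeneous-hereditary A) (homogeneous-attainable A))

HomogeneousBelow : ℕ → ColouringProperty r
HomogeneousBelow K c = ∀ k → k < K → HomogeneousAt k c

homogeneousBelow-hereditary : ∀ K → Hereditary (HomogeneousBelow {r} K)
homogeneousBelow-hereditary K c c′ z eq below k k<K =
  homogeneousAt-hereditary k c c′ z eq (below k k<K)

homogeneousBelow-attainable : ∀ K → Attainable (HomogeneousBelow {r} K)
homogeneousBelow-attainable zero    t = t , λ c → ⊑-refl , λ k ()
homogeneousBelow-attainable (suc K) =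
  attainable-mono {P = λ c → HomogeneousBelow K c × HomogeneousAt K c}
                  {Q = HomogeneousBelow (suc K)}
    (λ { c (below , at) k k<1+K → [ below k , (λ { refl → at }) ]′ (m<1+n⇒m<n∨m≡n k<1+K) })
    (attainable-× {P = HomogeneousBelow K} {Q = HomogeneousAt K}
       (homogeneousBelow-hereditary K) (homogeneousAt-hereditary K)
       (homogeneousBelow-attainable K) (homogeneousAt-attainable K))

-- The canonical Ramsey theorem

-- The two r-subsets of Fin (suc r) whose i-th element sits at position i, resp. i + 1.
early late : Fin r → r ⊑ suc r
early {suc r} zero    = keep (skip ⊑-refl)
early {suc r} (suc i) = keep (early i)
late  {suc r} zero    = skip ⊑-refl
late  {suc r} (suc i) = keep (late i)

Movable : Fin r → (r ⊑ n → ℕ) → Set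
Movable i c = ∀ S → c (early i ⨾ S) ≡ c (late i ⨾ S)

_∶ᵗ_ : r ⊑ n → Subset r → Subset n
skip e ∶ᵗ J       = false ∷ (e ∶ᵗ J)
keep e ∶ᵗ (b ∷ J) = b ∷ (e ∶ᵗ J)
done   ∶ᵗ []      = []

⊑-refl-∶ᵗ : (J : Subset r) → ⊑-refl ∶ᵗ J ≡ J
⊑-refl-∶ᵗ []      = refl
⊑-refl-∶ᵗ (b ∷ J) = cong (b ∷_) (⊑-refl-∶ᵗ J)

⨾-∶ᵗ : (s : k ⊑ l) (w : l ⊑ n) (J : Subset k) → (s ⨾ w) ∶ᵗ J ≡ w ∶ᵗ (s ∶ᵗ J)
⨾-∶ᵗ s        (skip w) J       = cong (false ∷_) (⨾-∶ᵗ s w J)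
⨾-∶ᵗ (keep s) (keep w) (b ∷ J) = cong (b ∷_) (⨾-∶ᵗ s w J)
⨾-∶ᵗ (skip s) (keep w) J       = cong (false ∷_) (⨾-∶ᵗ s w J)
⨾-∶ᵗ done     done     []      = refl

movable-keep : ∀ {b J} (c : suc r ⊑ suc n → ℕ) → (∀ i → i ∉ b ∷ J → Movable i c) →
               ∀ i → i ∉ J → Movable i (λ u → c (keep u))
movable-keep c movable i i∉J S = movable (suc i) (i∉J ∘ drop-there) (keep S)

∶ᵗ-determines : (J : Subset r) (c : r ⊑ n → ℕ) → (∀ i → i ∉ J → Movable i c) →
                ∀ e e′ → e ∶ᵗ J ≡ e′ ∶ᵗ J → c e ≡ c e′
slide-first : ∀ {b} (J : Subset r) (c : suc r ⊑ suc n → ℕ) → (∀ i → i ∉ b ∷ J → Movable i c) →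
              ∀ e e′ → keep e ∶ᵗ (b ∷ J) ≡ skip e′ ∶ᵗ (b ∷ J) → c (keep e) ≡ c (skip e′)

∶ᵗ-determines J       c movable (skip e) (skip e′) eq =
  ∶ᵗ-determines J (λ u → c (skip u)) (λ i i∉J S → movable i i∉J (skip S)) e e′ (∷-injectiveʳ eq)
∶ᵗ-determines (b ∷ J) c movable (keep e) (keep e′) eq =
  ∶ᵗ-determines J (λ u → c (keep u)) (movable-keep c movable) e e′ (∷-injectiveʳ eq)
∶ᵗ-determines (b ∷ J) c movable (keep e) (skip e′) eq = slide-first J c movable e e′ eq
∶ᵗ-determines (b ∷ J) c movable (skip e) (keep e′) eq = sym (slide-first J c movable e′ e (sym eq))
∶ᵗ-determines []      c movable done     done      eq = refl

slide-first J c movable e e′ eq with ∷-injectiveˡ eq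
... | refl = begin
  c (keep e)                   ≡⟨ ∶ᵗ-determines J (λ u → c (keep u)) (movable-keep c movable)
                                                e (skip ⊑-refl ⨾ e′) tails ⟩
  c (keep (skip ⊑-refl ⨾ e′))  ≡⟨ movable zero (λ ()) (keep e′) ⟩
  c (skip (⊑-refl ⨾ e′))       ≡⟨ cong (λ u → c (skip u)) (⨾-identityˡ e′) ⟩
  c (skip e′)                  ∎
  where
  open ≡-Reasoning
  tails : e ∶ᵗ J ≡ (skip ⊑-refl ⨾ e′) ∶ᵗ J
  tails = trans (∷-injectiveʳ eq)
                (sym (trans (⨾-∶ᵗ (skip ⊑-refl) e′ J)
                            (cong (λ X → e′ ∶ᵗ (false ∷ X)) (⊑-refl-∶ᵗ J))))

∈-tabulate⁻ : ∀ {f : Fin n → Bool} {x} → x ∈ tabulate f → f x ≡ true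
∈-tabulate⁻ {f = f} {x} x∈ = trans (sym (lookup∘tabulate f x)) ([]=⇒lookup x∈)

∈-tabulate⁺ : ∀ {f : Fin n → Bool} {x} → f x ≡ true → x ∈ tabulate f
∈-tabulate⁺ {f = f} {x} fx≡true = lookup⇒[]= x (tabulate f) (trans (lookup∘tabulate f x) fx≡true)

record RigidPositions {T} (c : r ⊑ T → ℕ) : Set where
  field
    J        : Subset r
    flexible : ∀ i → i ∉ J → Movable i c
    rigid    : ∀ i → i ∈ J → ∀ S → c (early i ⨾ S) ≢ c (late i ⨾ S)

rigidPositions : {T : ℕ} (c : r ⊑ T → ℕ) → HomogeneousAt (suc r) c → RigidPositions c
rigidPositions {r} {T} c hom with suc r ≤? T
... | no r≮T = record
  { J = ∅ ; flexible = λ i _ S → ⊥-elim (r≮T (⊑⇒≤ S)) ; rigid = λ i _ S → ⊥-elim (r≮T (⊑⇒≤ S)) }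
... | yes r<T = record { J = tabulate rigidAt ; flexible = flexible ; rigid = rigid }
  where
  S₀ : suc r ⊑ T
  S₀ = ≤⇒⊑ r<T
  rigidAt : Fin r → Bool
  rigidAt i = not (does (c (early i ⨾ S₀) ≟ c (late i ⨾ S₀)))
  flexible : ∀ i → i ∉ tabulate rigidAt → Movable i c
  flexible i i∉J S with c (early i ⨾ S₀) ≟ c (late i ⨾ S₀) in eq
  ... | yes eq₀ = hom (early i) (late i) S₀ S eq₀
  ... | no _    = ⊥-elim (i∉J (∈-tabulate⁺ (cong (not ∘ does) eq)))
  rigid : ∀ i → i ∈ tabulate rigidAt → ∀ S → c (early i ⨾ S) ≢ c (late i ⨾ S)
  rigid i i∈J S eqS with c (early i ⨾ S₀) ≟ c (late i ⨾ S₀) in eq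
  ... | yes _  = contradiction (trans (sym (cong (not ∘ does) eq)) (∈-tabulate⁻ i∈J)) λ ()
  ... | no neq = neq (hom (early i) (late i) S S₀ eqS)

data Nth : k ⊑ n → Fin k → Fin n → Set where
  nth-here : {e : k ⊑ n} → Nth (keep e) zero zero
  nth-keep : {e : k ⊑ n} {i : Fin k} {x : Fin n} → Nth e i x → Nth (keep e) (suc i) (suc x)
  nth-skip : {e : k ⊑ n} {i : Fin k} {x : Fin n} → Nth e i x → Nth (skip e) i (suc x)

data Misses : k ⊑ n → Fin n → Set where
  miss-here : {e : k ⊑ n} → Misses (skip e) zero
  miss-keep : {e : k ⊑ n} {x : Fin n} → Misses e x → Misses (keep e) (suc x)
  miss-skip : {e : k ⊑ n} {x : Fin n} → Misses e x → Misses (skip e) (suc x)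

misses-or-nth : (e : k ⊑ n) (x : Fin n) → Misses e x ⊎ ∃ λ i → Nth e i x
misses-or-nth (skip e) zero    = inj₁ miss-here
misses-or-nth (keep e) zero    = inj₂ (zero , nth-here)
misses-or-nth (skip e) (suc x) =
  Sum.map miss-skip (λ (i , nth) → i , nth-skip nth) (misses-or-nth e x)
misses-or-nth (keep e) (suc x) =
  Sum.map miss-keep (λ (i , nth) → suc i , nth-keep nth) (misses-or-nth e x)

∈-∶ᵗ⁻ : (e : r ⊑ n) (J : Subset r) {x : Fin n} → x ∈ e ∶ᵗ J → ∃ λ i → Nth e i x × i ∈ J
∈-∶ᵗ⁻ (skip e) J       (there x∈) = let i , nth , i∈J = ∈-∶ᵗ⁻ e J x∈ in i , nth-skip nth , i∈J
∈-∶ᵗ⁻ (keep e) (b ∷ J) here       = zero , nth-here , here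
∈-∶ᵗ⁻ (keep e) (b ∷ J) (there x∈) =
  let i , nth , i∈J = ∈-∶ᵗ⁻ e J x∈ in suc i , nth-keep nth , there i∈J

∈-∶ᵗ⁺ : {e : r ⊑ n} {J : Subset r} {i : Fin r} {x : Fin n} → Nth e i x → i ∈ J → x ∈ e ∶ᵗ J
∈-∶ᵗ⁺ nth-here       here        = here
∈-∶ᵗ⁺ (nth-keep nth) (there i∈J) = there (∈-∶ᵗ⁺ nth i∈J)
∈-∶ᵗ⁺ (nth-skip nth) i∈J         = there (∈-∶ᵗ⁺ nth i∈J)

Shifted : Fin r → r ⊑ n → r ⊑ n → Set
Shifted i u v = ∃ λ S → u ≡ late i ⨾ S × v ≡ early i ⨾ S

shifted-here : (u : r ⊑ n) → Shifted zero (skip (keep u)) (keep (skip u))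
shifted-here u =
  keep (keep u) , cong (skip ∘ keep) (sym (⨾-identityˡ u)) , cong (keep ∘ skip) (sym (⨾-identityˡ u))

shifted-skip : ∀ {i : Fin r} {u v : r ⊑ n} → Shifted i u v → Shifted i (skip u) (skip v)
shifted-skip (S , u≡ , v≡) = skip S , cong skip u≡ , cong skip v≡

shifted-keep : ∀ {i : Fin r} {u v : r ⊑ n} → Shifted i u v → Shifted (suc i) (keep u) (keep v)
shifted-keep (S , u≡ , v≡) = keep S , cong keep u≡ , cong keep v≡

-- Slide i u v f: v is u with its i-th element moved one position down, and f occupies neither
-- of the two positions involved.
data Slide : Fin r → r ⊑ n → r ⊑ n → l ⊑ n → Set where
  here  : {u : r ⊑ n} {f : l ⊑ n} → Slide zero (skip (keep u)) (keep (skip u)) (skip (skip f))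
  skip₀ : {i : Fin r} {u v : r ⊑ n} {f : l ⊑ n} →
          Slide i u v f → Slide i (skip u) (skip v) (skip f)
  skip₁ : {i : Fin r} {u v : r ⊑ n} {f : l ⊑ n} →
          Slide i u v f → Slide i (skip u) (skip v) (keep f)
  keep₀ : {i : Fin r} {u v : r ⊑ n} {f : l ⊑ n} →
          Slide i u v f → Slide (suc i) (keep u) (keep v) (skip f)
  keep₁ : {i : Fin r} {u v : r ⊑ n} {f : l ⊑ n} →
          Slide i u v f → Slide (suc i) (keep u) (keep v) (keep f)

slide-shifted : {i : Fin r} {u v : r ⊑ n} {f : l ⊑ n} → Slide i u v f → Shifted i u v
slide-shifted (here {u = u}) = shifted-here u
slide-shifted (skip₀ sl)     = shifted-skip (slide-shifted sl)
slide-shifted (skip₁ sl)     = shifted-skip (slide-shifted sl)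
slide-shifted (keep₀ sl)     = shifted-keep (slide-shifted sl)
slide-shifted (keep₁ sl)     = shifted-keep (slide-shifted sl)

record Union (u : a ⊑ n) (f : l ⊑ n) : Set where
  field
    size  : ℕ
    size≤ : size ≤ a + l
    A     : a ⊑ size
    B     : l ⊑ size
    U     : size ⊑ n
    u≡A⨾U : u ≡ A ⨾ U
    f≡B⨾U : f ≡ B ⨾ U

union : (u : a ⊑ n) (f : l ⊑ n) → Union u f
union done done = record
  { size = 0 ; size≤ = z≤n ; A = done ; B = done ; U = done ; u≡A⨾U = refl ; f≡B⨾U = refl }
union (skip u) (skip f) = record
  { Union (union u f) ; U = skip U ; u≡A⨾U = cong skip u≡A⨾U ; f≡B⨾U = cong skip f≡B⨾U }
  where open Union (union u f)
union (keep u) (skip f) = record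
  { size = suc size ; size≤ = s≤s size≤ ; A = keep A ; B = skip B ; U = keep U
  ; u≡A⨾U = cong keep u≡A⨾U ; f≡B⨾U = cong skip f≡B⨾U }
  where open Union (union u f)
union {a} {l = suc l} (skip u) (keep f) = record
  { size = suc size ; size≤ = subst (suc size ≤_) (sym (+-suc a l)) (s≤s size≤)
  ; A = skip A ; B = keep B ; U = keep U
  ; u≡A⨾U = cong skip u≡A⨾U ; f≡B⨾U = cong keep f≡B⨾U }
  where open Union (union u f)
union {suc a} {l = suc l} (keep u) (keep f) = record
  { size = suc size ; size≤ = s≤s (≤-trans size≤ (+-monoʳ-≤ a (n≤1+n l)))
  ; A = keep A ; B = keep B ; U = keep U
  ; u≡A⨾U = cong keep u≡A⨾U ; f≡B⨾U = cong keep f≡B⨾U }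
  where open Union (union u f)

OrderType : ℕ → ℕ → Set
OrderType a l = Σ ℕ λ k → a ⊑ k × l ⊑ k

shape : {u : a ⊑ n} {f : l ⊑ n} → Union u f → OrderType a l
shape p = size , A , B
  where open Union p

orderType : (u : a ⊑ n) (f : l ⊑ n) → OrderType a l
orderType u f = shape (union u f)

slide-orderType : {i : Fin r} {u v : r ⊑ n} {f : l ⊑ n} → Slide i u v f →
                  orderType u f ≡ orderType v f
slide-orderType here       = refl
slide-orderType (skip₀ sl) = slide-orderType sl
slide-orderType (skip₁ sl) = cong (λ (k , A , B) → suc k , skip A , keep B) (slide-orderType sl)
slide-orderType (keep₀ sl) = cong (λ (k , A , B) → suc k , keep A , skip B) (slide-orderType sl)
slide-orderType (keep₁ sl) = cong (λ (k , A , B) → suc k , keep A , keep B) (slide-orderType sl)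

-- Level suc r is where J is read off; levels up to r + r cover the order type of two r-sets.
module HomogeneousColouring {T} (c : r ⊑ T → ℕ) (hom : HomogeneousBelow (suc (suc (r + r))) c) where

  sameOrderType-≡ : {u v f : r ⊑ T} (p : Union u f) (q : Union v f) → shape p ≡ shape q →
                    c u ≡ c f → c v ≡ c f
  sameOrderType-≡
    record { size = k ; size≤ = k≤ ; A = A ; B = B ; U = U ; u≡A⨾U = refl ; f≡B⨾U = refl }
    record { U = U′ ; u≡A⨾U = refl ; f≡B⨾U = f≡B⨾U′ } refl eq =
    trans (hom k (s≤s (m≤n⇒m≤1+n k≤)) A B U U′ eq) (cong c (sym f≡B⨾U′))

  slide-≡ : {i : Fin r} {u v f : r ⊑ T} → Slide i u v f → c u ≡ c f → c v ≡ c f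
  slide-≡ {u = u} {v} {f} sl = sameOrderType-≡ (union u f) (union v f) (slide-orderType sl)

  open RigidPositions (rigidPositions c (hom (suc r) (s≤s (s≤s (m≤m+n r r))))) public

  shifted-≢ : {i : Fin r} {u v : r ⊑ T} → Shifted i u v → i ∈ J → c v ≢ c u
  shifted-≢ (S , refl , refl) i∈J = rigid _ i∈J S

  shifted-≡ : {i : Fin r} {u v : r ⊑ T} → Shifted i u v → i ∉ J → c v ≡ c u
  shifted-≡ (S , refl , refl) i∉J = flexible _ i∉J S

triple : ℕ → ℕ
triple zero    = zero
triple (suc t) = suc (suc (suc (triple t)))

-- Element x goes to position 3x + 1, so that positions 3x and 3x + 2 are free in every spread set.
spread : k ⊑ t → k ⊑ triple t
spread done     = done
spread (keep e) = skip (keep (skip (spread e)))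
spread (skip e) = skip (skip (skip (spread e)))

spread-⨾ : (s : a ⊑ k) (e : k ⊑ t) → spread (s ⨾ e) ≡ s ⨾ spread e
spread-⨾ s        (skip e) = cong (skip ∘ skip ∘ skip) (spread-⨾ s e)
spread-⨾ (keep s) (keep e) = cong (skip ∘ keep ∘ skip) (spread-⨾ s e)
spread-⨾ (skip s) (keep e) = cong (skip ∘ skip ∘ skip) (spread-⨾ s e)
spread-⨾ done     done     = refl

slide-past-miss : {e : r ⊑ t} {f : l ⊑ t} {i : Fin r} {x : Fin t} → Nth e i x → Misses f x →
                  ∃ λ v → Slide i (spread e) v (spread f)
slide-past-miss nth-here       miss-here        = _ , here
slide-past-miss (nth-keep nth) (miss-keep miss) =
  let _ , sl = slide-past-miss nth miss in _ , skip₀ (keep₁ (skip₀ sl))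
slide-past-miss (nth-keep nth) (miss-skip miss) =
  let _ , sl = slide-past-miss nth miss in _ , skip₀ (keep₀ (skip₀ sl))
slide-past-miss (nth-skip nth) (miss-keep miss) =
  let _ , sl = slide-past-miss nth miss in _ , skip₀ (skip₁ (skip₀ sl))
slide-past-miss (nth-skip nth) (miss-skip miss) =
  let _ , sl = slide-past-miss nth miss in _ , skip₀ (skip₀ (skip₀ sl))

-- x moves down in spread e and up in spread f.
slide-past-hit : {e : r ⊑ t} {f : l ⊑ t} {i : Fin r} {j : Fin l} {x : Fin t} →
                 Nth e i x → Nth f j x → ∃₂ λ v h → Slide i (spread e) v h × Shifted j h (spread f)
slide-past-hit {f = keep f} nth-here nth-here =
  _ , _ , here , shifted-skip (shifted-here (spread f))
slide-past-hit (nth-keep nth) (nth-keep nth′) =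
  let _ , _ , sl , sh = slide-past-hit nth nth′
  in _ , _ , skip₀ (keep₁ (skip₀ sl)) , shifted-skip (shifted-keep (shifted-skip sh))
slide-past-hit (nth-keep nth) (nth-skip nth′) =
  let _ , _ , sl , sh = slide-past-hit nth nth′
  in _ , _ , skip₀ (keep₀ (skip₀ sl)) , shifted-skip (shifted-skip (shifted-skip sh))
slide-past-hit (nth-skip nth) (nth-keep nth′) =
  let _ , _ , sl , sh = slide-past-hit nth nth′
  in _ , _ , skip₀ (skip₁ (skip₀ sl)) , shifted-skip (shifted-keep (shifted-skip sh))
slide-past-hit (nth-skip nth) (nth-skip nth′) =
  let _ , _ , sl , sh = slide-past-hit nth nth′
  in _ , _ , skip₀ (skip₀ (skip₀ sl)) , shifted-skip (shifted-skip (shifted-skip sh))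

Canonical : Subset r → (r ⊑ t → ℕ) → Set
Canonical J c = ∀ e e′ → c e ≡ c e′ ⇔ e ∶ᵗ J ≡ e′ ∶ᵗ J

canonical-resp : {J : Subset r} {c d : r ⊑ t → ℕ} → (∀ e → c e ≡ d e) →
                 Canonical J d → Canonical J c
canonical-resp c≗d canonical e e′ = mk⇔
  (λ eq → Equivalence.to (canonical e e′) (trans (sym (c≗d e)) (trans eq (c≗d e′))))
  (λ eq → trans (c≗d e) (trans (Equivalence.from (canonical e e′) eq) (sym (c≗d e′))))

module _ {t} (c : r ⊑ triple t → ℕ) (hom : HomogeneousBelow (suc (suc (r + r))) c) where
  open HomogeneousColouring c hom

  -- Moving the i-th element of spread e (i ∈ J, its element x ∉ f ∶ᵗ J) keeps the order type
  -- relative to spread f, or to spread f with x moved up when x ∈ f at a position outside J.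
  spread-∶ᵗ-⊆ : {e f : r ⊑ t} → c (spread e) ≡ c (spread f) → e ∶ᵗ J ⊆ f ∶ᵗ J
  spread-∶ᵗ-⊆ {e} {f} eq {x} x∈ with ∈-∶ᵗ⁻ e J x∈
  ... | i , nth , i∈J with misses-or-nth f x
  ...   | inj₁ miss =
    let _ , sl = slide-past-miss nth miss
    in contradiction (trans (slide-≡ sl eq) (sym eq)) (shifted-≢ (slide-shifted sl) i∈J)
  ...   | inj₂ (j , nth′) with j ∈? J
  ...     | yes j∈J = ∈-∶ᵗ⁺ nth′ j∈J
  ...     | no j∉J =
    let _ , _ , sl , sh = slide-past-hit nth nth′
        fh = shifted-≡ sh j∉J
    in contradiction (trans (slide-≡ sl (trans eq fh)) (trans (sym fh) (sym eq)))
                     (shifted-≢ (slide-shifted sl) i∈J)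

  spread-movable : ∀ i → i ∉ J → Movable i (λ e → c (spread e))
  spread-movable i i∉J S = begin
    c (spread (early i ⨾ S))  ≡⟨ cong c (spread-⨾ (early i) S) ⟩
    c (early i ⨾ spread S)    ≡⟨ flexible i i∉J (spread S) ⟩
    c (late i ⨾ spread S)     ≡⟨ cong c (spread-⨾ (late i) S) ⟨
    c (spread (late i ⨾ S))   ∎
    where open ≡-Reasoning

  spread-canonical : Canonical J (λ e → c (spread e))
  spread-canonical e e′ = mk⇔
    (λ eq → ⊆-antisym (spread-∶ᵗ-⊆ eq) (spread-∶ᵗ-⊆ (sym eq)))
    (∶ᵗ-determines J (λ e → c (spread e)) spread-movable e e′)

canonicalRamsey : ∀ r t →
  ∃[ N ] ∀ (c : r ⊑ N → ℕ) → ∃ λ (w : t ⊑ N) → ∃ λ J → Canonical J (c ↾ w)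
canonicalRamsey r t =
  let N , attain = homogeneousBelow-attainable (suc (suc (r + r))) (triple t)
  in N , λ c →
    let y , hom = attain c
    in spread ⊑-refl ⨾ y , _ ,
       canonical-resp (λ e → cong c (spread-⨾-refl e y)) (spread-canonical (c ↾ y) hom)
  where
  spread-⨾-refl : (e : r ⊑ t) (y : triple t ⊑ N) → e ⨾ (spread ⊑-refl ⨾ y) ≡ spread e ⨾ y
  spread-⨾-refl e y = begin
    e ⨾ (spread ⊑-refl ⨾ y)   ≡⟨ ⨾-assoc e (spread ⊑-refl) y ⟨
    e ⨾ spread ⊑-refl ⨾ y     ≡⟨ cong (_⨾ y) (spread-⨾ e ⊑-refl) ⟨
    spread (e ⨾ ⊑-refl) ⨾ y   ≡⟨ cong (λ s → spread s ⨾ y) (⨾-identityʳ e) ⟩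
    spread e ⨾ y              ∎
    where open ≡-Reasoning

-- Subsets and thinnings

toSubset : k ⊑ n → Subset n
toSubset done     = []
toSubset (keep e) = true ∷ toSubset e
toSubset (skip e) = false ∷ toSubset e

fromSubset : (p : Subset n) → ∣ p ∣ ≡ k → ∃ λ (e : k ⊑ n) → toSubset e ≡ p
fromSubset []          refl = done , refl
fromSubset (true ∷ p)  refl = let e , eq = fromSubset p refl in keep e , cong (true ∷_) eq
fromSubset (false ∷ p) size = let e , eq = fromSubset p size in skip e , cong (false ∷_) eq

embed : k ⊑ n → Fin k → Fin n
embed (skip w) x       = suc (embed w x)
embed (keep w) zero    = zero
embed (keep w) (suc x) = suc (embed w x)

embed-injective : (w : k ⊑ n) → Injective _≡_ _≡_ (embed w)
embed-injective (skip w)                 eq = embed-injective w (Fin.suc-injective eq)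
embed-injective (keep w) {zero}  {zero}  eq = refl
embed-injective (keep w) {suc x} {suc y} eq = cong suc (embed-injective w (Fin.suc-injective eq))

embed-∈ : (e : r ⊑ k) (w : k ⊑ n) {x : Fin k} → x ∈ toSubset e → embed w x ∈ toSubset (e ⨾ w)
embed-∈ e        (skip w) x∈         = there (embed-∈ e w x∈)
embed-∈ (keep e) (keep w) here       = here
embed-∈ (keep e) (keep w) (there x∈) = there (embed-∈ e w x∈)
embed-∈ (skip e) (keep w) (there x∈) = there (embed-∈ e w x∈)

∈-toSubset-⨾ : (e : r ⊑ k) (w : k ⊑ n) {y : Fin n} → y ∈ toSubset (e ⨾ w) →
               ∃ λ x → x ∈ toSubset e × embed w x ≡ y
∈-toSubset-⨾ e        (skip w) (there y∈) =
  let x , x∈ , eq = ∈-toSubset-⨾ e w y∈ in x , x∈ , cong suc eq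
∈-toSubset-⨾ (keep e) (keep w) here       = zero , here , refl
∈-toSubset-⨾ (keep e) (keep w) (there y∈) =
  let x , x∈ , eq = ∈-toSubset-⨾ e w y∈ in suc x , there x∈ , cong suc eq
∈-toSubset-⨾ (skip e) (keep w) (there y∈) =
  let x , x∈ , eq = ∈-toSubset-⨾ e w y∈ in suc x , there x∈ , cong suc eq

from-does : {A : Set} (d : Dec A) → does d ≡ true → A
from-does (yes a) _ = a

∈-image⁻ : (φ : Fin a → Fin n) (p : Subset a) {y : Fin n} → y ∈ image φ p →
           ∃ λ x → x ∈ p × φ x ≡ y
∈-image⁻ φ p {y} y∈ =
  let x , px≡true , φx≡y =
        from-does (any? λ x → (lookup p x ≟ᵇ true) ×-dec (φ x ≟ᶠ y)) (∈-tabulate⁻ y∈)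
  in x , lookup⇒[]= x p px≡true , φx≡y

∈-image⁺ : (φ : Fin a → Fin n) (p : Subset a) {x : Fin a} → x ∈ p → φ x ∈ image φ p
∈-image⁺ φ p {x} x∈ = ∈-tabulate⁺
  (dec-true (any? λ x′ → (lookup p x′ ≟ᵇ true) ×-dec (φ x′ ≟ᶠ φ x)) (x , []=⇒lookup x∈ , refl))

image-embed-toSubset : (e : r ⊑ k) (w : k ⊑ n) → image (embed w) (toSubset e) ≡ toSubset (e ⨾ w)
image-embed-toSubset e w = ⊆-antisym
  (λ y∈ → let x , x∈ , eq = ∈-image⁻ (embed w) (toSubset e) y∈
          in subst (_∈ toSubset (e ⨾ w)) eq (embed-∈ e w x∈))
  (λ y∈ → let x , x∈ , eq = ∈-toSubset-⨾ e w y∈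
          in subst (_∈ image (embed w) (toSubset e)) eq (∈-image⁺ (embed w) (toSubset e) x∈))

∣∩-empty∣ : (p : Subset n) → ∣ p ∩ tabulate (λ _ → false) ∣ ≡ 0
∣∩-empty∣ []          = refl
∣∩-empty∣ (true ∷ p)  = ∣∩-empty∣ p
∣∩-empty∣ (false ∷ p) = ∣∩-empty∣ p

lookup-∶ : (e : r ⊑ n) (J : Subset r) (x : Fin n) →
           lookup (toSubset e) x ∧ lookupℕ J (rank (toSubset e) x) ≡ lookup (e ∶ᵗ J) x
lookup-∶ (skip e) J       zero    = refl
lookup-∶ (skip e) J       (suc x) = lookup-∶ e J x
-- rank p zero computes to ∣ p ∩ tabulate (λ _ → false) ∣.
lookup-∶ (keep e) (b ∷ J) zero    = cong (lookupℕ (b ∷ J)) (∣∩-empty∣ (toSubset e))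
lookup-∶ (keep e) (b ∷ J) (suc x) = lookup-∶ e J x

toSubset-∶ : (e : r ⊑ n) (J : Subset r) → toSubset e ∶ J ≡ e ∶ᵗ J
toSubset-∶ e J = trans (tabulate-cong (lookup-∶ e J)) (tabulate∘lookup (e ∶ᵗ J))

image-∘ : (f : Fin b → Fin n) (g : Fin a → Fin b) (p : Subset a) →
          image (f ∘ g) p ≡ image f (image g p)
image-∘ f g p = ⊆-antisym
  (λ y∈ → let x , x∈ , eq = ∈-image⁻ (f ∘ g) p y∈
          in subst (_∈ image f (image g p)) eq (∈-image⁺ f (image g p) (∈-image⁺ g p x∈)))
  (λ y∈ → let z , z∈ , fz≡y = ∈-image⁻ f (image g p) y∈
              x , x∈ , gx≡z = ∈-image⁻ g p z∈
          in subst (_∈ image (f ∘ g) p) (trans (cong f gx≡z) fz≡y) (∈-image⁺ (f ∘ g) p x∈))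

image-false : (φ : Fin (suc a) → Fin n) (p : Subset a) → image φ (false ∷ p) ≡ image (φ ∘ suc) p
image-false φ p = ⊆-antisym
  (λ y∈ → case ∈-image⁻ φ (false ∷ p) y∈ of λ where
     (suc x , there x∈ , eq) → subst (_∈ image (φ ∘ suc) p) eq (∈-image⁺ (φ ∘ suc) p x∈))
  (λ y∈ → let x , x∈ , eq = ∈-image⁻ (φ ∘ suc) p y∈
          in subst (_∈ image φ (false ∷ p)) eq (∈-image⁺ φ (false ∷ p) (there x∈)))

image-true : (φ : Fin (suc a) → Fin n) (p : Subset a) →
             image φ (true ∷ p) ≡ ⁅ φ zero ⁆ ∪ image (φ ∘ suc) p
image-true φ p = ⊆-antisym
  (λ y∈ → case ∈-image⁻ φ (true ∷ p) y∈ of λ where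
     (zero  , _        , refl) → x∈p∪q⁺ (inj₁ (x∈⁅x⁆ (φ zero)))
     (suc x , there x∈ , refl) → x∈p∪q⁺ (inj₂ (∈-image⁺ (φ ∘ suc) p x∈)))
  (λ y∈ → case x∈p∪q⁻ ⁅ φ zero ⁆ (image (φ ∘ suc) p) y∈ of λ where
     (inj₁ y∈⁅φ0⁆) → subst (_∈ image φ (true ∷ p)) (sym (x∈⁅y⁆⇒x≡y (φ zero) y∈⁅φ0⁆))
                            (∈-image⁺ φ (true ∷ p) here)
     (inj₂ y∈img)  → let x , x∈ , eq = ∈-image⁻ (φ ∘ suc) p y∈img
                     in subst (_∈ image φ (true ∷ p)) eq (∈-image⁺ φ (true ∷ p) (there x∈)))

∣⁅x⁆∪p∣ : (x : Fin n) (p : Subset n) → x ∉ p → ∣ ⁅ x ⁆ ∪ p ∣ ≡ suc ∣ p ∣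
∣⁅x⁆∪p∣ zero    (true ∷ p)  x∉p = contradiction here x∉p
∣⁅x⁆∪p∣ zero    (false ∷ p) x∉p = cong (suc ∘ ∣_∣) (∪-identityˡ p)
∣⁅x⁆∪p∣ (suc x) (true ∷ p)  x∉p = cong suc (∣⁅x⁆∪p∣ x p (x∉p ∘ there))
∣⁅x⁆∪p∣ (suc x) (false ∷ p) x∉p = ∣⁅x⁆∪p∣ x p (x∉p ∘ there)

∣image∣ : (φ : Fin a → Fin n) → Injective _≡_ _≡_ φ → (p : Subset a) → ∣ image φ p ∣ ≡ ∣ p ∣
∣image∣ {n = n} φ injective [] =
  trans (cong ∣_∣ (Empty-unique λ (_ , y∈) → Fin.¬Fin0 (proj₁ (∈-image⁻ φ [] y∈)))) (∣⊥∣≡0 n)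
∣image∣ φ injective (false ∷ p) =
  trans (cong ∣_∣ (image-false φ p)) (∣image∣ (φ ∘ suc) (Fin.suc-injective ∘ injective) p)
∣image∣ φ injective (true ∷ p) = begin
  ∣ image φ (true ∷ p) ∣              ≡⟨ cong ∣_∣ (image-true φ p) ⟩
  ∣ ⁅ φ zero ⁆ ∪ image (φ ∘ suc) p ∣  ≡⟨ ∣⁅x⁆∪p∣ (φ zero) (image (φ ∘ suc) p) φ0∉ ⟩
  suc ∣ image (φ ∘ suc) p ∣           ≡⟨ cong suc (∣image∣ (φ ∘ suc) injective′ p) ⟩
  suc ∣ p ∣                           ∎
  where
  open ≡-Reasoning
  injective′ : Injective _≡_ _≡_ (φ ∘ suc)
  injective′ = Fin.suc-injective ∘ injective
  φ0∉ : φ zero ∉ image (φ ∘ suc) p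
  φ0∉ φ0∈ = let x , _ , eq = ∈-image⁻ (φ ∘ suc) p φ0∈ in Fin.0≢1+n (injective (sym eq))

-- Copies under pullbacks and coarsenings

pullback : (Fin a → Fin n) → Coloring n → Coloring a
pullback φ c p = c (image φ p)

monoCopy-pullback : (H : RGraph r) (φ : Fin a → Fin n) → Injective _≡_ _≡_ φ → (c : Coloring n) →
                    MonoCopy H (pullback φ c) → MonoCopy H c
monoCopy-pullback H φ φ-inj c (ψ , ψ-inj , col , mono) =
  φ ∘ ψ , ψ-inj ∘ φ-inj , col , λ e e∈H → trans (cong c (image-∘ φ ψ e)) (mono e e∈H)

rainbowCopy-pullback : (G : RGraph r) (φ : Fin a → Fin n) → Injective _≡_ _≡_ φ →
                       (c : Coloring n) → RainbowCopy G (pullback φ c) → RainbowCopy G c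
rainbowCopy-pullback G φ φ-inj c (ψ , ψ-inj , rainbow) =
  φ ∘ ψ , ψ-inj ∘ φ-inj , λ e e′ e∈G e′∈G eq →
    rainbow e e′ e∈G e′∈G
      (trans (cong c (sym (image-∘ φ ψ e))) (trans eq (cong c (image-∘ φ ψ e′))))

arrows-suc : (H G : RGraph r) → Arrows n H G → Arrows (suc n) H G
arrows-suc H G arrows c =
  Sum.map (monoCopy-pullback H suc Fin.suc-injective c)
          (rainbowCopy-pullback G suc Fin.suc-injective c)
          (arrows (pullback suc c))

∣image-edge∣ : (H : RGraph r) (φ : Fin (m H) → Fin n) → Injective _≡_ _≡_ φ →
               ∀ e → E H e → ∣ image φ e ∣ ≡ r
∣image-edge∣ H φ φ-inj e e∈H = trans (∣image∣ φ φ-inj e) (uniform H e e∈H)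

Coarsening : ℕ → Coloring n → Coloring n → Set
Coarsening {n} r c c′ = (e e′ : Subset n) → ∣ e ∣ ≡ r → ∣ e′ ∣ ≡ r → c e ≡ c e′ → c′ e ≡ c′ e′

monoCopy-coarsening : (H : RGraph r) {c c′ : Coloring n} → Coarsening r c c′ →
                      MonoCopy H c → MonoCopy H c′
monoCopy-coarsening {r} H {c} {c′} coarse (φ , φ-inj , col , mono)
  with anySubset? (λ x → (∣ x ∣ ≟ r) ×-dec (c x ≟ col))
... | yes (x , ∣x∣≡r , cx≡col) = φ , φ-inj , c′ x , λ e e∈H →
  coarse (image φ e) x (∣image-edge∣ H φ φ-inj e e∈H) ∣x∣≡r (trans (mono e e∈H) (sym cx≡col))
-- No r-set has colour col, so H has no edges and any colour will do.
... | no ∄x = φ , φ-inj , 0 , λ e e∈H →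
  contradiction (image φ e , ∣image-edge∣ H φ φ-inj e e∈H , mono e e∈H) ∄x

rainbowCopy-coarsening : (G : RGraph r) {c c′ : Coloring n} → Coarsening r c′ c →
                         RainbowCopy G c → RainbowCopy G c′
rainbowCopy-coarsening G coarse (φ , φ-inj , rainbow) = φ , φ-inj , λ e e′ e∈G e′∈G eq →
  rainbow e e′ e∈G e′∈G
    (coarse (image φ e) (image φ e′) (∣image-edge∣ G φ φ-inj e e∈G) (∣image-edge∣ G φ φ-inj e′ e′∈G)
            eq)

jCanonical-coarsening : {J : Subset r} {c c′ : Coloring n} →
                        JCanonical J c → JCanonical J c′ → Coarsening r c c′
jCanonical-coarsening can can′ e e′ ∣e∣ ∣e′∣ =
  proj₂ (can′ e e′ ∣e∣ ∣e′∣) ∘ proj₁ (can e e′ ∣e∣ ∣e′∣)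

encode : Subset n → ℕ
encode []          = 0
encode (false ∷ p) = 2 * encode p
encode (true ∷ p)  = suc (2 * encode p)

encode-injective : (p q : Subset n) → encode p ≡ encode q → p ≡ q
encode-injective []          []          _  = refl
encode-injective (false ∷ p) (false ∷ q) eq =
  cong (false ∷_) (encode-injective p q (*-cancelˡ-≡ (encode p) (encode q) 2 eq))
encode-injective (true ∷ p)  (true ∷ q)  eq =
  cong (true ∷_) (encode-injective p q (*-cancelˡ-≡ (encode p) (encode q) 2 (suc-injective eq)))
encode-injective (false ∷ p) (true ∷ q)  eq = contradiction eq (even≢odd (encode p) (encode q))
encode-injective (true ∷ p)  (false ∷ q) eq = contradiction (sym eq) (even≢odd (encode q) (encode p))

encode-jCanonical : (J : Subset r) → JCanonical {n = n} J (λ e → encode (e ∶ J))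
encode-jCanonical J e e′ _ _ = encode-injective (e ∶ J) (e′ ∶ J) , cong encode

canonical⇒jCanonical : {J : Subset r} {c : Coloring n} → Canonical J (c ∘ toSubset) → JCanonical J c
canonical⇒jCanonical {J = J} can x x′ ∣x∣≡r ∣x′∣≡r with fromSubset x ∣x∣≡r | fromSubset x′ ∣x′∣≡r
... | e , refl | e′ , refl =
  (λ eq → trans (toSubset-∶ e J) (trans (Equivalence.to (can e e′) eq) (sym (toSubset-∶ e′ J)))) ,
  (λ eq → Equivalence.from (can e e′) (trans (sym (toSubset-∶ e J)) (trans eq (toSubset-∶ e′ J))))

CanonicalDichotomy : ℕ → RGraph r → RGraph r → Set
CanonicalDichotomy {r} t H G = (J : Subset r) →
  ((c : Coloring t) → JCanonical J c → MonoCopy H c)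
  ⊎ ((c : Coloring t) → JCanonical J c → RainbowCopy G c)

arrows⇒canonicalDichotomy : (H G : RGraph r) → Arrows t H G → CanonicalDichotomy t H G
arrows⇒canonicalDichotomy H G arrows J = Sum.map
  (λ mono c c-can →
     monoCopy-coarsening H (jCanonical-coarsening {J = J} (encode-jCanonical J) c-can) mono)
  (λ rainbow c c-can →
     rainbowCopy-coarsening G (jCanonical-coarsening {J = J} c-can (encode-jCanonical J)) rainbow)
  (arrows λ e → encode (e ∶ J))

canonicalDichotomy⇒fExists : (H G : RGraph r) → CanonicalDichotomy t H G → fExists H G
canonicalDichotomy⇒fExists {r} {t} H G dichotomy =
  let N , canon = canonicalRamsey r t
  in N , λ c →
    let w , J , can = canon (c ∘ toSubset)
        c-can : JCanonical J (pullback (embed w) c)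
        c-can = canonical⇒jCanonical (canonical-resp (λ e → cong c (image-embed-toSubset e w)) can)
    in Sum.map (λ mono → monoCopy-pullback H (embed w) (embed-injective w) c (mono _ c-can))
               (λ rainbow → rainbowCopy-pullback G (embed w) (embed-injective w) c (rainbow _ c-can))
               (dichotomy J)

proposition7p1 : (r : ℕ) → 2 ≤ r → (H G : RGraph r) →
    fExists H G ⇔
      (∃ λ (t : ℕ) → 1 ≤ t × ((J : Subset r) →
        ((c : Coloring t) → JCanonical J c → MonoCopy H c)
        ⊎ ((c : Coloring t) → JCanonical J c → RainbowCopy G c)))
proposition7p1 r _ H G = mk⇔
  (λ (n , arrows) → suc n , s≤s z≤n , arrows⇒canonicalDichotomy H G (arrows-suc H G arrows))
  (λ (t , _ , dichotomy) → canonicalDichotomy⇒fExists H G dichotomy)
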